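{- Let $\sigma$ be a symmetry of the input formula with support $\{x_{i_1},\dots,x_{i_k}\}$, $i_1<\dots<i_k$, $k=|\mathrm{supp}(\sigma)|$. Then, from the constraint $t_k\ge1$ together with the circuit constraints below, the following symmetry breaking clauses can be derived using $O(k)$ RUP steps and cutting planes steps (writing $x_j'$ for $x_{i_j}$): $s_1+\bar x_1'\ge1$; $s_{j+1}+\bar s_j+\bar x_{j+1}'\ge1$ for $1\le j\le k-2$; $s_1+\sigma(x_1')\ge1$; $s_{j+1}+\bar s_j+\sigma(x_{j+1}')\ge1$ for $1\le j\le k-2$; $\sigma(x_1')+\bar x_1'\ge1$; $\bar s_j+\sigma(x_{j+1}')+\bar x_{j+1}'\ge1$ for $1\le j\le k-1$.
   Context: Literals: $x$ or $\bar x=1-x$. A symmetry $\sigma$ is a permutation of literals with $\sigma(\bar\ell)=\overline{\sigma(\ell)}$ and finite support $\mathrm{supp}(\sigma)=\{x:\sigma(x)\ne x\}$ mapping the input formula to itself syntactically. Circuit constraints over fresh variables $s_1..s_{k-1}$, $t_1..t_k$: $\bar s_1+x_1'+\overline{\sigma(x_1')}\ge1$; $2s_1+\bar x_1'+\sigma(x_1')\ge2$; for $1\le j\le k-2$: $3\bar s_{j+1}+2s_j+x_{j+1}'+\overline{\sigma(x_{j+1}')}\ge3$, $2s_{j+1}+2\bar s_j+\bar x_{j+1}'+\sigma(x_{j+1}')\ge2$; $\bar t_1+\sigma(x_1')+\bar x_1'\ge1$; $2t_1+\overline{\sigma(x_1')}+x_1'\ge2$; for $1\le j\le k-1$: $4\bar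 t_{j+1}+3t_j+\bar s_j+\sigma(x_{j+1}')+\bar x_{j+1}'\ge4$, $3t_{j+1}+3\bar t_j+s_j+\overline{\sigma(x_{j+1}')}+x_{j+1}'\ge3$. RUP step: derive $C$ from premises $F$ if unit propagation on $F\cup\{\neg C\}$ from the empty assignment reaches a conflict, where $\neg(\sum a_i\ell_i\ge A)\doteq\sum a_i\bar\ell_i\ge\sum a_i-A+1$. Cutting planes steps: addition, positive scaling, saturation, weakening, division with rounding up, literal axioms. -}

module Defs where

open import Data.Bool using (Bool; true; false; if_then_else_; not; _xor_)
open import Data.Nat as ℕ using (ℕ; zero; suc; _∸_; _<ᵇ_; _≡ᵇ_; _⊔_; _⊓_; NonZero)
open import Data.Nat.DivMod using (_/_)
open import Data.Integer as ℤ using (ℤ; +_; -[1+_]; 0ℤ; ∣_∣)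
open import Data.List using (List; []; _∷_; map; concatMap; length; upTo; _++_)
open import Data.List.Membership.Propositional using (_∈_; _∉_)
open import Data.List.Relation.Unary.Any using (Any)
open import Data.List.Relation.Unary.All using (All)
open import Data.List.Relation.Unary.Linked using (Linked)
open import Data.List.Relation.Binary.Permutation.Propositional using (_↭_)
open import Data.Maybe using (Maybe; just; nothing)
open import Data.Product using (Σ; _×_; _,_; ∃; ∃-syntax)
open import Data.Sum using (_⊎_)
open import Relation.Binary.PropositionalEquality using (_≡_; _≢_)

-- Literals over variables ℕ :  pos x = x,  neg x = x̄ = 1 - x

data Lit : Set where
  pos : ℕ → Lit
  neg : ℕ → Lit

var : Lit → ℕ
var (pos x) = x
var (neg x) = x

~_ : Lit → Lit
~ pos x = neg x
~ neg x = pos x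

-- Pseudo-Boolean constraints, stored in normalised variable form
--   Σ_{v < bound} coef v · x_v ≥ deg      (integer coefficients)
-- Variables v ≥ bound have coefficient 0 (see cf).

record Con : Set where
  constructor con
  field
    bound : ℕ
    coef  : ℕ → ℤ
    deg   : ℤ
open Con public

cf : Con → ℕ → ℤ
cf C v = if v <ᵇ bound C then coef C v else 0ℤ

sumTo : ℕ → (ℕ → ℤ) → ℤ
sumTo zero    f = 0ℤ
sumTo (suc n) f = sumTo n f ℤ.+ f n

nonneg : ℤ → Bool
nonneg (+ _)    = true
nonneg -[1+ _ ] = false

negPart : ℤ → ℕ
negPart (+ _)     = 0
negPart -[1+ n ]  = suc n

posPart : ℤ → ℕ
posPart (+ n)    = n
posPart -[1+ _ ] = 0

-- Normalised literal view  Σ a_v ℓ_v ≥ A  (a_v ≥ 0):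
-- ℓ_v = x_v if lpol C v = true, ℓ_v = x̄_v otherwise.
lc : Con → ℕ → ℕ
lc C v = ∣ cf C v ∣

lpol : Con → ℕ → Bool
lpol C v = nonneg (cf C v)

ldeg : Con → ℤ
ldeg C = deg C ℤ.+ sumTo (bound C) (λ v → + negPart (cf C v))

fromLit : ℕ → (ℕ → ℕ) → (ℕ → Bool) → ℤ → Con
fromLit b a p A =
  con b (λ v → if p v then + a v else ℤ.- (+ a v))
        (A ℤ.- sumTo b (λ v → if p v then 0ℤ else + a v))

Term : Set
Term = ℕ × Lit

signed : Term → ℤ
signed (a , pos _) = + a
signed (a , neg _) = ℤ.- (+ a)

negConst : Term → ℤ
negConst (a , pos _) = 0ℤ
negConst (a , neg _) = + a

maxVar : List Term → ℕ
maxVar []             = 0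
maxVar ((_ , l) ∷ ts) = var l ⊔ maxVar ts

coefOf : List Term → ℕ → ℤ
coefOf []             v = 0ℤ
coefOf ((a , l) ∷ ts) v =
  (if var l ≡ᵇ v then signed (a , l) else 0ℤ) ℤ.+ coefOf ts v

sumNeg : List Term → ℤ
sumNeg []       = 0ℤ
sumNeg (t ∷ ts) = negConst t ℤ.+ sumNeg ts

mk : List Term → ℕ → Con
mk ts A = con (suc (maxVar ts)) (coefOf ts) (+ A ℤ.- sumNeg ts)

_≈ᶜ_ : Con → Con → Set
C ≈ᶜ D = (∀ v → cf C v ≡ cf D v) × (deg C ≡ deg D)

_⊕_ : Con → Con → Con
C ⊕ D = con (bound C ⊔ bound D) (λ v → cf C v ℤ.+ cf D v) (deg C ℤ.+ deg D)

scale : ℕ → Con → Con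
scale c C = con (bound C) (λ v → + c ℤ.* cf C v) (+ c ℤ.* deg C)

saturate : Con → Con
saturate C = fromLit (bound C) (λ v → lc C v ⊓ posPart (ldeg C)) (lpol C) (ldeg C)

ceilDiv : ℕ → (c : ℕ) → .{{NonZero c}} → ℕ
ceilDiv n c = (n ℕ.+ (c ∸ 1)) / c

ceilDivℤ : ℤ → (c : ℕ) → .{{NonZero c}} → ℤ
ceilDivℤ (+ n)    c = + ceilDiv n c
ceilDivℤ -[1+ n ] c = ℤ.- (+ (suc n / c))

divide : (c : ℕ) → .{{NonZero c}} → Con → Con
divide c C = fromLit (bound C) (λ v → ceilDiv (lc C v) c) (lpol C) (ceilDivℤ (ldeg C) c)

weaken : ℕ → Con → Con
weaken u C = fromLit (bound C) (λ v → if v ≡ᵇ u then 0 else lc C v) (lpol C)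
                     (ldeg C ℤ.- + lc C u)

litAxiom : Lit → Con
litAxiom l = mk ((1 , l) ∷ []) 0

negC : Con → Con
negC C = fromLit (bound C) (lc C) (λ v → not (lpol C v))
                 (sumTo (bound C) (λ v → + lc C v) ℤ.- ldeg C ℤ.+ + 1)

Assignment : Set
Assignment = List (ℕ × Bool)

val : Assignment → ℕ → Maybe Bool
val []            v = nothing
val ((w , b) ∷ ρ) v = if w ≡ᵇ v then just b else val ρ v

isFalse : Maybe Bool → Bool → Bool
isFalse nothing  p = false
isFalse (just b) p = b xor p

slack : Con → Assignment → ℤ
slack C ρ = sumTo (bound C) (λ v → if isFalse (val ρ v) (lpol C v) then 0ℤ else + lc C v)
            ℤ.- ldeg C

data UPConflict (F : List Con) : Assignment → Set where
  conflict  : ∀ {ρ C} → C ∈ F → slack C ρ ℤ.< 0ℤ → UPConflict F ρ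
  propagate : ∀ {ρ C} (v : ℕ) → C ∈ F → val ρ v ≡ nothing →
              slack C ρ ℤ.< + lc C v →
              UPConflict F ((v , lpol C v) ∷ ρ) → UPConflict F ρ

data Step (Γ : List Con) : Con → Set where
  rup    : (C : Con) → UPConflict (negC C ∷ Γ) [] → Step Γ C
  add    : ∀ {C D} → C ∈ Γ → D ∈ Γ → Step Γ (C ⊕ D)
  mul    : ∀ {C} (c : ℕ) → .{{_ : NonZero c}} → C ∈ Γ → Step Γ (scale c C)
  sat    : ∀ {C} → C ∈ Γ → Step Γ (saturate C)
  weak   : ∀ {C} (u : ℕ) → C ∈ Γ → Step Γ (weaken u C)
  div    : ∀ {C} (c : ℕ) → .{{_ : NonZero c}} → C ∈ Γ → Step Γ (divide c C)
  axiom  : (l : Lit) → Step Γ (litAxiom l)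

data Deriv (Γ : List Con) : ℕ → List Con → Set where
  done : Deriv Γ 0 Γ
  step : ∀ {C n Δ} → Step Γ C → Deriv (C ∷ Γ) n Δ → Deriv Γ (suc n) Δ

DerivableWithin : ℕ → List Con → List Con → Set
DerivableWithin n P T =
  ∃[ m ] ∃[ Δ ] (m ℕ.≤ n × Deriv P m Δ × All (λ G → Any (G ≈ᶜ_) Δ) T)

CNF : Set
CNF = List (List Lit)

record IsSymmetry (F : CNF) (σ : Lit → Lit) : Set where
  field
    σ-neg  : ∀ l → σ (~ l) ≡ ~ (σ l)
    σ-perm : Σ (Lit → Lit) λ τ → ((∀ l → τ (σ l) ≡ l) × (∀ l → σ (τ l) ≡ l))
    σ-F    : ∀ {C} → C ∈ F → Any (λ D → map σ C ↭ D) F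

IsSupport : (Lit → Lit) → List ℕ → Set
IsSupport σ xs = ∀ x → (x ∈ xs → σ (pos x) ≢ pos x) × (σ (pos x) ≢ pos x → x ∈ xs)

vars : CNF → List ℕ
vars F = concatMap (map var) F

-- index ranges of the fresh variables: s_1..s_{k-1} (s_1 always, as it
-- occurs in the circuit even when k = 1), t_1..t_k
SIdx : ℕ → ℕ → Set
SIdx k j = 1 ℕ.≤ j × j ℕ.≤ (k ∸ 1) ⊔ 1

TIdx : ℕ → ℕ → Set
TIdx k j = 1 ℕ.≤ j × j ℕ.≤ k

record Fresh (F : CNF) (xs : List ℕ) (s t : ℕ → ℕ) : Set where
  k = length xs
  field
    s-inj  : ∀ i j → SIdx k i → SIdx k j → s i ≡ s j → i ≡ j
    t-inj  : ∀ i j → TIdx k i → TIdx k j → t i ≡ t j → i ≡ j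
    s≢t    : ∀ i j → SIdx k i → TIdx k j → s i ≢ t j
    s∉supp : ∀ i → SIdx k i → s i ∉ xs
    t∉supp : ∀ j → TIdx k j → t j ∉ xs
    s∉F    : ∀ i → SIdx k i → s i ∉ vars F
    t∉F    : ∀ j → TIdx k j → t j ∉ vars F

nth : List ℕ → ℕ → ℕ
nth []       _       = 0
nth (x ∷ xs) zero    = x
nth (x ∷ xs) (suc n) = nth xs n

module Circuit (σ : Lit → Lit) (xs : List ℕ) (s t : ℕ → ℕ) where
  k : ℕ
  k = length xs

  -- x'_j = x_{i_j}  (1-based)
  x′ : ℕ → Lit
  x′ j = pos (nth xs (j ∸ 1))

  S S̄ T T̄ : ℕ → Lit
  S j = pos (s j)
  S̄ j = neg (s j)
  T j = pos (t j)
  T̄ j = neg (t j)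

  J2 J1 : List ℕ
  J2 = map suc (upTo (k ∸ 2))
  J1 = map suc (upTo (k ∸ 1))

  circuit : List Con
  circuit =
    mk ((1 , S̄ 1) ∷ (1 , x′ 1) ∷ (1 , ~ σ (x′ 1)) ∷ []) 1 ∷
    mk ((2 , S 1) ∷ (1 , ~ x′ 1) ∷ (1 , σ (x′ 1)) ∷ []) 2 ∷
    concatMap (λ j →
      mk ((3 , S̄ (suc j)) ∷ (2 , S j) ∷ (1 , x′ (suc j)) ∷ (1 , ~ σ (x′ (suc j))) ∷ []) 3 ∷
      mk ((2 , S (suc j)) ∷ (2 , S̄ j) ∷ (1 , ~ x′ (suc j)) ∷ (1 , σ (x′ (suc j))) ∷ []) 2 ∷ [])
      J2 ++
    mk ((1 , T̄ 1) ∷ (1 , σ (x′ 1)) ∷ (1 , ~ x′ 1) ∷ []) 1 ∷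
    mk ((2 , T 1) ∷ (1 , ~ σ (x′ 1)) ∷ (1 , x′ 1) ∷ []) 2 ∷
    concatMap (λ j →
      mk ((4 , T̄ (suc j)) ∷ (3 , T j) ∷ (1 , S̄ j) ∷ (1 , σ (x′ (suc j))) ∷ (1 , ~ x′ (suc j)) ∷ []) 4 ∷
      mk ((3 , T (suc j)) ∷ (3 , T̄ j) ∷ (1 , S j) ∷ (1 , ~ σ (x′ (suc j))) ∷ (1 , x′ (suc j)) ∷ []) 3 ∷ [])
      J1

  premises : List Con
  premises = mk ((1 , T k) ∷ []) 1 ∷ circuit

  targets : List Con
  targets =
    mk ((1 , S 1) ∷ (1 , ~ x′ 1) ∷ []) 1 ∷
    map (λ j → mk ((1 , S (suc j)) ∷ (1 , S̄ j) ∷ (1 , ~ x′ (suc j)) ∷ []) 1) J2 ++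
    mk ((1 , S 1) ∷ (1 , σ (x′ 1)) ∷ []) 1 ∷
    map (λ j → mk ((1 , S (suc j)) ∷ (1 , S̄ j) ∷ (1 , σ (x′ (suc j))) ∷ []) 1) J2 ++
    mk ((1 , σ (x′ 1)) ∷ (1 , ~ x′ 1) ∷ []) 1 ∷
    map (λ j → mk ((1 , S̄ j) ∷ (1 , σ (x′ (suc j))) ∷ (1 , ~ x′ (suc j)) ∷ []) 1) J1

module Submission where

-- For 1 ≤ j ≤ k − 1 the circuit contains
--   2s_j + 2s̄_{j−1} + x̄′_j + σ(x′_j) ≥ 2   (without the s̄-term when j = 1);
-- adding σ̄(x′_j) ≥ 0, respectively x′_j ≥ 0, leaves a constraint of degree 1 which division by 2
-- turns into the corresponding symmetry breaking clause. Division acts on the normalised form of a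
-- constraint, so it needs the variables of the constraint to be distinct: this is where the
-- freshness of s, and the fact that σ fixes every variable outside its support, are used.
-- The t-constraints are unwound from t_k ≥ 1 downwards: 4·(t_{j+1} ≥ 1) cancels 4t̄_{j+1} in
-- 4t̄_{j+1} + 3t_j + s̄_j + σ(x′_{j+1}) + x̄′_{j+1} ≥ 4. From the result, adding 3t̄_j ≥ 0 gives the
-- clause s̄_j + σ(x′_{j+1}) + x̄′_{j+1} ≥ 1, while weakening away its three unit literals and
-- dividing by 3 gives t_j ≥ 1. Finally t_1 ≥ 1 resolves t̄_1 + σ(x′_1) + x̄′_1 ≥ 1 to the last
-- clause. Each index costs a bounded number of steps, at most 24k in all.

open import Defs
open import Algebra.Properties.CommutativeSemigroup as CommSemigroupProps using ()
open import Data.Bool using (true; false; if_then_else_)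
open import Data.Nat as ℕ using (ℕ; zero; suc; _∸_; _<ᵇ_; _≡ᵇ_; _⊔_; NonZero; _*_; _≤_; _<_; z≤n; s≤s)
import Data.Nat.Properties as ℕₚ
open import Data.Nat.DivMod using (m<n⇒m/n≡0)
open import Data.Integer as ℤ using (ℤ; +_; 0ℤ; ∣_∣)
import Data.Integer.Properties as ℤₚ
open import Data.Integer.Tactic.RingSolver using (solve-∀)
open import Data.Nat.Tactic.RingSolver using () renaming (solve-∀ to ℕ-solve-∀)
open import Data.List.Relation.Unary.Linked using (Linked)
open import Data.List using (List; []; _∷_; _++_; map; length; upTo)
open import Data.List.Properties using (map-∘; length-upTo)
open import Data.List.Relation.Binary.Permutation.Propositional using (_↭_; prep; swap; ↭-refl; ↭-trans)
import Data.List.Relation.Binary.Permutation.Propositional as ↭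
open import Data.List.Relation.Binary.Permutation.Propositional.Properties using (++-comm; ∷↭∷ʳ)
open import Data.List.Relation.Unary.All as All using (All; []; _∷_)
import Data.List.Relation.Unary.All.Properties as All
open import Data.List.Relation.Unary.Any using (Any; here; there)
open import Data.List.Membership.Propositional using (_∈_; _∉_; lose)
open import Data.List.Membership.Propositional.Properties
  using (∈-map⁺; ∈-upTo⁺; ∈-upTo⁻; ∈-++⁺ˡ; ∈-++⁺ʳ; ∈-concatMap⁺)
open import Data.List.Relation.Binary.Subset.Propositional using (_⊆_)
open import Data.List.Relation.Binary.Subset.Propositional.Properties using (⊆-refl; ⊆-trans)
open import Data.List.Relation.Unary.AllPairs using ([]; _∷_)
open import Data.List.Relation.Unary.Unique.Propositional using (Unique)
open import Data.Product using (_×_; _,_; proj₁; proj₂; map₁; ∃-syntax)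
open import Data.Sum using (_⊎_; inj₁; inj₂; [_,_]′)
open import Function using (_∘_)
open import Level using (0ℓ)
open import Relation.Binary.Bundles using (Setoid)
import Relation.Binary.Reasoning.Setoid as SetoidReasoning
open import Relation.Binary.PropositionalEquality
  using (_≡_; _≢_; refl; sym; trans; cong; cong₂; subst; subst₂; module ≡-Reasoning)
open import Relation.Nullary using (yes; no; contradiction)
open import Relation.Nullary.Reflects using (ofʸ; ofⁿ)

open CommSemigroupProps ℤₚ.+-commutativeSemigroup using () renaming (x∙yz≈y∙xz to +-swapℤ)
open CommSemigroupProps ℕₚ.+-commutativeSemigroup using () renaming (x∙yz≈y∙xz to +-swapℕ)

-- Sums over a range of variables and over the terms of a constraint

≡ᵇ-refl : ∀ n → (n ≡ᵇ n) ≡ true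
≡ᵇ-refl zero    = refl
≡ᵇ-refl (suc n) = ≡ᵇ-refl n

≡ᵇ-≢ : ∀ {m n} → m ≢ n → (m ≡ᵇ n) ≡ false
≡ᵇ-≢ {zero}  {zero}  m≢n = contradiction refl m≢n
≡ᵇ-≢ {zero}  {suc n} _   = refl
≡ᵇ-≢ {suc m} {zero}  _   = refl
≡ᵇ-≢ {suc m} {suc n} m≢n = ≡ᵇ-≢ (m≢n ∘ cong suc)

sumTo-cong : ∀ M {f g : ℕ → ℤ} → (∀ v → f v ≡ g v) → sumTo M f ≡ sumTo M g
sumTo-cong zero    f≗g = refl
sumTo-cong (suc M) f≗g = cong₂ ℤ._+_ (sumTo-cong M f≗g) (f≗g M)

sumTo-+ : ∀ M (f g : ℕ → ℤ) → sumTo M (λ v → f v ℤ.+ g v) ≡ sumTo M f ℤ.+ sumTo M g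
sumTo-+ zero    f g = refl
sumTo-+ (suc M) f g =
  trans (cong (ℤ._+ (f M ℤ.+ g M)) (sumTo-+ M f g)) (shuffle (sumTo M f) (sumTo M g) (f M) (g M))
  where
  shuffle : ∀ (a b c d : ℤ) → (a ℤ.+ b) ℤ.+ (c ℤ.+ d) ≡ (a ℤ.+ c) ℤ.+ (b ℤ.+ d)
  shuffle = solve-∀

sumTo-zero : ∀ M → sumTo M (λ _ → 0ℤ) ≡ 0ℤ
sumTo-zero zero    = refl
sumTo-zero (suc M) = cong (ℤ._+ 0ℤ) (sumTo-zero M)

sumTo-extend : ∀ {b} M (f : ℕ → ℤ) → b ≤ M → (∀ v → b ≤ v → f v ≡ 0ℤ) → sumTo M f ≡ sumTo b f
sumTo-extend zero    f z≤n     _     = refl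
sumTo-extend {b} (suc M) f b≤1+M f-vanishes with ℕₚ.m≤n⇒m<n∨m≡n b≤1+M
... | inj₁ b≤M = begin
  sumTo M f ℤ.+ f M ≡⟨ cong (λ z → sumTo M f ℤ.+ z) (f-vanishes M (ℕ.s≤s⁻¹ b≤M)) ⟩
  sumTo M f ℤ.+ 0ℤ  ≡⟨ ℤₚ.+-identityʳ _ ⟩
  sumTo M f         ≡⟨ sumTo-extend M f (ℕ.s≤s⁻¹ b≤M) f-vanishes ⟩
  sumTo b f         ∎
  where open ≡-Reasoning
... | inj₂ refl = refl

sumTo-indicator-absent : ∀ {x} M (c : ℤ) → M ≤ x → sumTo M (λ v → if x ≡ᵇ v then c else 0ℤ) ≡ 0ℤ
sumTo-indicator-absent zero    c _ = refl
sumTo-indicator-absent (suc M) c M<x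
  rewrite ≡ᵇ-≢ (ℕₚ.>⇒≢ M<x) | sumTo-indicator-absent M c (ℕₚ.<⇒≤ M<x) = refl

sumTo-indicator : ∀ {x} M (c : ℤ) → x < M → sumTo M (λ v → if x ≡ᵇ v then c else 0ℤ) ≡ c
sumTo-indicator (suc M) c x<1+M with ℕₚ.m≤n⇒m<n∨m≡n (ℕ.s≤s⁻¹ x<1+M)
... | inj₁ x<M rewrite ≡ᵇ-≢ (ℕₚ.<⇒≢ x<M) =
  trans (ℤₚ.+-identityʳ _) (sumTo-indicator M c x<M)
... | inj₂ refl rewrite ≡ᵇ-refl M | sumTo-indicator-absent M c ℕₚ.≤-refl = ℤₚ.+-identityˡ c

termVar : Term → ℕ
termVar (_ , l) = var l

sumTerms : (Term → ℤ) → List Term → ℤ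
sumTerms g []       = 0ℤ
sumTerms g (t ∷ ts) = g t ℤ.+ sumTerms g ts

onVar : ℕ → (Term → ℤ) → Term → ℤ
onVar v g t = if termVar t ≡ᵇ v then g t else 0ℤ

coefOf-sumTerms : ∀ ts v → coefOf ts v ≡ sumTerms (onVar v signed) ts
coefOf-sumTerms []       v = refl
coefOf-sumTerms (t ∷ ts) v = cong (λ z → onVar v signed t ℤ.+ z) (coefOf-sumTerms ts v)

sumNeg-sumTerms : ∀ ts → sumNeg ts ≡ sumTerms negConst ts
sumNeg-sumTerms []       = refl
sumNeg-sumTerms (t ∷ ts) = cong (λ z → negConst t ℤ.+ z) (sumNeg-sumTerms ts)

sumTerms-cong : ∀ {g h} ts → (∀ t → g t ≡ h t) → sumTerms g ts ≡ sumTerms h ts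
sumTerms-cong []       g≗h = refl
sumTerms-cong (t ∷ ts) g≗h = cong₂ ℤ._+_ (g≗h t) (sumTerms-cong ts g≗h)

sumTerms-map : ∀ g f ts → sumTerms g (map f ts) ≡ sumTerms (g ∘ f) ts
sumTerms-map g f []       = refl
sumTerms-map g f (t ∷ ts) = cong (λ z → g (f t) ℤ.+ z) (sumTerms-map g f ts)

sumTerms-++ : ∀ g ts us → sumTerms g (ts ++ us) ≡ sumTerms g ts ℤ.+ sumTerms g us
sumTerms-++ g []       us = sym (ℤₚ.+-identityˡ _)
sumTerms-++ g (t ∷ ts) us =
  trans (cong (λ z → g t ℤ.+ z) (sumTerms-++ g ts us)) (sym (ℤₚ.+-assoc (g t) _ _))

sumTerms-↭ : ∀ g {ts us} → ts ↭ us → sumTerms g ts ≡ sumTerms g us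
sumTerms-↭ g ↭.refl            = refl
sumTerms-↭ g (prep t p)        = cong (λ z → g t ℤ.+ z) (sumTerms-↭ g p)
sumTerms-↭ g (swap t u p)      =
  trans (cong (λ z → g t ℤ.+ (g u ℤ.+ z)) (sumTerms-↭ g p)) (+-swapℤ (g t) (g u) _)
sumTerms-↭ g (↭.trans p q)     = trans (sumTerms-↭ g p) (sumTerms-↭ g q)

sumTerms-*ˡ : ∀ c g ts → sumTerms (λ t → c ℤ.* g t) ts ≡ c ℤ.* sumTerms g ts
sumTerms-*ˡ c g []       = sym (ℤₚ.*-zeroʳ c)
sumTerms-*ˡ c g (t ∷ ts) =
  trans (cong (λ z → c ℤ.* g t ℤ.+ z) (sumTerms-*ˡ c g ts)) (sym (ℤₚ.*-distribˡ-+ c (g t) _))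

sumTerms-onVar-beyond : ∀ g ts {v} → maxVar ts < v → sumTerms (onVar v g) ts ≡ 0ℤ
sumTerms-onVar-beyond g []             _    = refl
sumTerms-onVar-beyond g ((a , l) ∷ ts) max<v
  rewrite ≡ᵇ-≢ (ℕₚ.<⇒≢ (ℕₚ.m⊔n<o⇒m<o (var l) (maxVar ts) max<v))
        | sumTerms-onVar-beyond g ts (ℕₚ.m⊔n<o⇒n<o (var l) (maxVar ts) max<v) = refl

sumTerms-onVar-∉ : ∀ g ts {v} → All (v ≢_) (map termVar ts) → sumTerms (onVar v g) ts ≡ 0ℤ
sumTerms-onVar-∉ g []       []            = refl
sumTerms-onVar-∉ g (t ∷ ts) (v≢t ∷ v∉ts)
  rewrite ≡ᵇ-≢ (v≢t ∘ sym) | sumTerms-onVar-∉ g ts v∉ts = refl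

-- With distinct variables each variable carries at most one term.
onVar-commute : ∀ (H : ℤ → ℤ) → H 0ℤ ≡ 0ℤ → ∀ g {ts} → Unique (map termVar ts) → ∀ v →
                H (sumTerms (onVar v g) ts) ≡ sumTerms (onVar v (H ∘ g)) ts
onVar-commute H H0 g {[]}           []                   v = H0
onVar-commute H H0 g {(a , l) ∷ ts} (l∉ts ∷ distinct) v with var l ℕₚ.≟ v
... | yes refl
  rewrite ≡ᵇ-refl (var l) | sumTerms-onVar-∉ g ts l∉ts | sumTerms-onVar-∉ (H ∘ g) ts l∉ts =
  trans (cong H (ℤₚ.+-identityʳ _)) (sym (ℤₚ.+-identityʳ _))
... | no l≢v rewrite ≡ᵇ-≢ l≢v =
  trans (cong H (ℤₚ.+-identityˡ _))
        (trans (onVar-commute H H0 g distinct v) (sym (ℤₚ.+-identityˡ _)))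

sumTo-onVar : ∀ g ts {M} → maxVar ts < M → sumTo M (λ v → sumTerms (onVar v g) ts) ≡ sumTerms g ts
sumTo-onVar g []             {M} _     = sumTo-zero M
sumTo-onVar g ((a , l) ∷ ts) {M} max<M =
  trans (sumTo-+ M (λ v → onVar v g (a , l)) (λ v → sumTerms (onVar v g) ts))
        (cong₂ ℤ._+_ (sumTo-indicator M (g (a , l)) (ℕₚ.m⊔n<o⇒m<o (var l) (maxVar ts) max<M))
                      (sumTo-onVar g ts (ℕₚ.m⊔n<o⇒n<o (var l) (maxVar ts) max<M)))

-- Constraints given by lists of terms, up to equivalence

cf-beyond : ∀ C {v} → bound C ≤ v → cf C v ≡ 0ℤ
cf-beyond C {v} b≤v with v <ᵇ bound C | ℕₚ.<ᵇ-reflects-< v (bound C)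
... | false | _       = refl
... | true  | ofʸ v<b = contradiction b≤v (ℕₚ.<⇒≱ v<b)

cf-mk : ∀ ts A v → cf (mk ts A) v ≡ sumTerms (onVar v signed) ts
cf-mk ts A v with v <ᵇ suc (maxVar ts) | ℕₚ.<ᵇ-reflects-< v (suc (maxVar ts))
... | true  | _       = coefOf-sumTerms ts v
... | false | ofⁿ v≮b = sym (sumTerms-onVar-beyond signed ts (ℕₚ.≮⇒≥ v≮b))

deg-mk : ∀ ts A → deg (mk ts A) ≡ + A ℤ.- sumTerms negConst ts
deg-mk ts A = cong (λ z → + A ℤ.- z) (sumNeg-sumTerms ts)

cf-⊕ : ∀ C D v → cf (C ⊕ D) v ≡ cf C v ℤ.+ cf D v
cf-⊕ C D v with v <ᵇ bound C ⊔ bound D | ℕₚ.<ᵇ-reflects-< v (bound C ⊔ bound D)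
... | true  | _       = refl
... | false | ofⁿ v≮b = sym (cong₂ ℤ._+_
  (cf-beyond C (ℕₚ.m⊔n≤o⇒m≤o (bound C) (bound D) (ℕₚ.≮⇒≥ v≮b)))
  (cf-beyond D (ℕₚ.m⊔n≤o⇒n≤o (bound C) (bound D) (ℕₚ.≮⇒≥ v≮b))))

cf-scale : ∀ c C v → cf (scale c C) v ≡ + c ℤ.* cf C v
cf-scale c C v with v <ᵇ bound C
... | true  = refl
... | false = sym (ℤₚ.*-zeroʳ (+ c))

-- _≈ᶜ_ as a record type, so that Agda can infer the constraints it relates
record _≅_ (C D : Con) : Set where
  constructor _,_
  field
    cf≗  : ∀ v → cf C v ≡ cf D v
    deg≡ : deg C ≡ deg D

infix 4 _≅_

≅⇒≈ᶜ : ∀ {C D} → C ≅ D → C ≈ᶜ D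
≅⇒≈ᶜ (cf≗ , deg≡) = cf≗ , deg≡

≅-refl : ∀ {C} → C ≅ C
≅-refl = (λ _ → refl) , refl

≅-sym : ∀ {C D} → C ≅ D → D ≅ C
≅-sym (cf≗ , deg≡) = (λ v → sym (cf≗ v)) , sym deg≡

≅-trans : ∀ {C D E} → C ≅ D → D ≅ E → C ≅ E
≅-trans (cf≗ , deg≡) (cf≗′ , deg≡′) = (λ v → trans (cf≗ v) (cf≗′ v)) , trans deg≡ deg≡′

≅-setoid : Setoid 0ℓ 0ℓ
≅-setoid = record
  { Carrier       = Con
  ; _≈_           = _≅_
  ; isEquivalence = record { refl = ≅-refl ; sym = ≅-sym ; trans = ≅-trans }
  }

mk-≅ : ∀ ts A C → (∀ v → sumTerms (onVar v signed) ts ≡ cf C v) →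
        + A ℤ.- sumTerms negConst ts ≡ deg C → mk ts A ≅ C
mk-≅ ts A C cf≗ deg≡ = (λ v → trans (cf-mk ts A v) (cf≗ v)) , trans (deg-mk ts A) deg≡

⊕-cong : ∀ {C C′ D D′} → C ≅ C′ → D ≅ D′ → (C ⊕ D) ≅ (C′ ⊕ D′)
⊕-cong {C} {C′} {D} {D′} (cf≗ , deg≡) (cf≗′ , deg≡′) =
  (λ v → trans (cf-⊕ C D v) (trans (cong₂ ℤ._+_ (cf≗ v) (cf≗′ v)) (sym (cf-⊕ C′ D′ v)))) ,
  cong₂ ℤ._+_ deg≡ deg≡′

scale-cong : ∀ c {C D} → C ≅ D → scale c C ≅ scale c D
scale-cong c {C} {D} (cf≗ , deg≡) =
  (λ v → trans (cf-scale c C v) (trans (cong (+ c ℤ.*_) (cf≗ v)) (sym (cf-scale c D v)))) ,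
  cong (+ c ℤ.*_) deg≡

⊕-identityˡ : ∀ C → (mk [] 0 ⊕ C) ≅ C
⊕-identityˡ C =
  (λ v → trans (cf-⊕ (mk [] 0) C v)
               (trans (cong (ℤ._+ cf C v) (cf-mk [] 0 v)) (ℤₚ.+-identityˡ (cf C v)))) ,
  ℤₚ.+-identityˡ (deg C)

mk-++ : ∀ ts us A B → mk (ts ++ us) (A ℕ.+ B) ≅ (mk ts A ⊕ mk us B)
mk-++ ts us A B = mk-≅ (ts ++ us) (A ℕ.+ B) (mk ts A ⊕ mk us B)
  (λ v → trans (sumTerms-++ (onVar v signed) ts us)
               (sym (trans (cf-⊕ (mk ts A) (mk us B) v) (cong₂ ℤ._+_ (cf-mk ts A v) (cf-mk us B v)))))
  (trans (cong₂ (λ a z → a ℤ.- z) (ℤₚ.pos-+ A B) (sumTerms-++ negConst ts us))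
    (trans (regroup (+ A) (+ B) (sumTerms negConst ts) (sumTerms negConst us))
           (sym (cong₂ ℤ._+_ (deg-mk ts A) (deg-mk us B)))))
  where
  regroup : ∀ (a b x y : ℤ) → (a ℤ.+ b) ℤ.- (x ℤ.+ y) ≡ (a ℤ.- x) ℤ.+ (b ℤ.- y)
  regroup = solve-∀

mk-↭ : ∀ {ts us} A → ts ↭ us → mk ts A ≅ mk us A
mk-↭ {ts} {us} A p = mk-≅ ts A (mk us A)
  (λ v → trans (sumTerms-↭ (onVar v signed) p) (sym (cf-mk us A v)))
  (trans (cong (λ z → + A ℤ.- z) (sumTerms-↭ negConst p)) (sym (deg-mk us A)))

signed-scale : ∀ c t → signed (map₁ (c *_) t) ≡ + c ℤ.* signed t
signed-scale c (a , pos _) = ℤₚ.pos-* c a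
signed-scale c (a , neg _) = trans (cong ℤ.-_ (ℤₚ.pos-* c a)) (ℤₚ.neg-distribʳ-* (+ c) (+ a))

negConst-scale : ∀ c t → negConst (map₁ (c *_) t) ≡ + c ℤ.* negConst t
negConst-scale c (a , pos _) = sym (ℤₚ.*-zeroʳ (+ c))
negConst-scale c (a , neg _) = ℤₚ.pos-* c a

onVar-scale : ∀ c v t → onVar v signed (map₁ (c *_) t) ≡ + c ℤ.* onVar v signed t
onVar-scale c v (a , l) with var l ≡ᵇ v
... | true  = signed-scale c (a , l)
... | false = sym (ℤₚ.*-zeroʳ (+ c))

mk-scale : ∀ c ts A → mk (map (map₁ (c *_)) ts) (c * A) ≅ scale c (mk ts A)
mk-scale c ts A = mk-≅ (map (map₁ (c *_)) ts) (c * A) (scale c (mk ts A))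
  (λ v → begin
    sumTerms (onVar v signed) (map (map₁ (c *_)) ts) ≡⟨ sumTerms-map (onVar v signed) (map₁ (c *_)) ts ⟩
    sumTerms (onVar v signed ∘ map₁ (c *_)) ts      ≡⟨ sumTerms-cong ts (onVar-scale c v) ⟩
    sumTerms (λ t → + c ℤ.* onVar v signed t) ts    ≡⟨ sumTerms-*ˡ (+ c) (onVar v signed) ts ⟩
    + c ℤ.* sumTerms (onVar v signed) ts            ≡⟨ cong (+ c ℤ.*_) (cf-mk ts A v) ⟨
    + c ℤ.* cf (mk ts A) v                          ≡⟨ cf-scale c (mk ts A) v ⟨
    cf (scale c (mk ts A)) v                        ∎)
  (begin
    + (c * A) ℤ.- sumTerms negConst (map (map₁ (c *_)) ts)
      ≡⟨ cong₂ (λ a z → a ℤ.- z) (ℤₚ.pos-* c A)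
               (trans (sumTerms-map negConst (map₁ (c *_)) ts)
                      (trans (sumTerms-cong ts (negConst-scale c)) (sumTerms-*ˡ (+ c) negConst ts))) ⟩
    + c ℤ.* + A ℤ.- + c ℤ.* sumTerms negConst ts
      ≡⟨ factor (+ c) (+ A) (sumTerms negConst ts) ⟩
    + c ℤ.* (+ A ℤ.- sumTerms negConst ts)
      ≡⟨ cong (+ c ℤ.*_) (deg-mk ts A) ⟨
    + c ℤ.* deg (mk ts A) ∎)
  where
  open ≡-Reasoning
  factor : ∀ (c a n : ℤ) → c ℤ.* a ℤ.- c ℤ.* n ≡ c ℤ.* (a ℤ.- n)
  factor = solve-∀

onVar-pair : ∀ a l v → onVar v signed (a , ~ l) ℤ.+ onVar v signed (a , l) ≡ 0ℤ
onVar-pair a (pos x) v with x ≡ᵇ v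
... | true  = ℤₚ.+-inverseˡ (+ a)
... | false = refl
onVar-pair a (neg x) v with x ≡ᵇ v
... | true  = ℤₚ.+-inverseʳ (+ a)
... | false = refl

negConst-pair : ∀ a l → negConst (a , ~ l) ℤ.+ negConst (a , l) ≡ + a
negConst-pair a (pos _) = ℤₚ.+-identityʳ (+ a)
negConst-pair a (neg _) = refl

mk-pair : ∀ a l → mk ((a , ~ l) ∷ (a , l) ∷ []) a ≅ mk [] 0
mk-pair a l = mk-≅ ((a , ~ l) ∷ (a , l) ∷ []) a (mk [] 0)
  (λ v → trans (cong (λ z → onVar v signed (a , ~ l) ℤ.+ z) (ℤₚ.+-identityʳ _))
               (trans (onVar-pair a l v) (sym (cf-mk [] 0 v))))
  (trans (cong (λ z → + a ℤ.- z) (trans (cong (λ z → negConst (a , ~ l) ℤ.+ z) (ℤₚ.+-identityʳ _))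
                                         (negConst-pair a l)))
         (ℤₚ.+-inverseʳ (+ a)))

mk-cancel : ∀ a l ts A → mk ((a , ~ l) ∷ (a , l) ∷ ts) (a ℕ.+ A) ≅ mk ts A
mk-cancel a l ts A = begin
  mk ((a , ~ l) ∷ (a , l) ∷ ts) (a ℕ.+ A)            ≈⟨ mk-++ ((a , ~ l) ∷ (a , l) ∷ []) ts a A ⟩
  (mk ((a , ~ l) ∷ (a , l) ∷ []) a ⊕ mk ts A)        ≈⟨ ⊕-cong (mk-pair a l) (≅-refl {mk ts A}) ⟩
  (mk [] 0 ⊕ mk ts A)                                ≈⟨ ⊕-identityˡ (mk ts A) ⟩
  mk ts A                                            ∎
  where open SetoidReasoning ≅-setoid

-- Division

ceilDiv-zero : ∀ c .{{_ : NonZero c}} → ceilDiv 0 c ≡ 0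
ceilDiv-zero (suc c) = m<n⇒m/n≡0 (ℕₚ.n<1+n c)

ceilTerm : (c : ℕ) → .{{NonZero c}} → Term → Term
ceilTerm c = map₁ (λ a → ceilDiv a c)

ceilCoef ceilNeg : (c : ℕ) → .{{NonZero c}} → ℤ → ℤ
ceilCoef c z = if nonneg z then + ceilDiv ∣ z ∣ c else ℤ.- (+ ceilDiv ∣ z ∣ c)
ceilNeg  c z = if nonneg z then 0ℤ else + ceilDiv ∣ z ∣ c

ceilCoef-signed : ∀ c .{{_ : NonZero c}} t → ceilCoef c (signed t) ≡ signed (ceilTerm c t)
ceilCoef-signed c (a     , pos _) = refl
ceilCoef-signed c ⦃ c≢0 ⦄ (zero  , neg _) rewrite ceilDiv-zero c ⦃ c≢0 ⦄ = refl
ceilCoef-signed c (suc a , neg _) = refl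

ceilNeg-signed : ∀ c .{{_ : NonZero c}} t → ceilNeg c (signed t) ≡ negConst (ceilTerm c t)
ceilNeg-signed c (a     , pos _) = refl
ceilNeg-signed c ⦃ c≢0 ⦄ (zero  , neg _) rewrite ceilDiv-zero c ⦃ c≢0 ⦄ = refl
ceilNeg-signed c (suc a , neg _) = refl

negPart-signed : ∀ t → + negPart (signed t) ≡ negConst t
negPart-signed (a     , pos _) = refl
negPart-signed (zero  , neg _) = refl
negPart-signed (suc a , neg _) = refl

sumCf : (ℤ → ℤ) → Con → ℤ
sumCf f C = sumTo (bound C) (λ v → f (cf C v))

sumCf-cong : ∀ f → f 0ℤ ≡ 0ℤ → ∀ {C D} → C ≅ D → sumCf f C ≡ sumCf f D
sumCf-cong f f0 {C} {D} (cf≗ , _) = begin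
  sumTo (bound C) (f ∘ cf C) ≡⟨ sumTo-extend M (f ∘ cf C) (ℕₚ.m≤m⊔n (bound C) (bound D)) (vanishes C) ⟨
  sumTo M (f ∘ cf C)         ≡⟨ sumTo-cong M (cong f ∘ cf≗) ⟩
  sumTo M (f ∘ cf D)         ≡⟨ sumTo-extend M (f ∘ cf D) (ℕₚ.m≤n⊔m (bound C) (bound D)) (vanishes D) ⟩
  sumTo (bound D) (f ∘ cf D) ∎
  where
  open ≡-Reasoning
  M : ℕ
  M = bound C ⊔ bound D
  vanishes : ∀ E v → bound E ≤ v → f (cf E v) ≡ 0ℤ
  vanishes E v b≤v = trans (cong f (cf-beyond E b≤v)) f0

sumCf-mk : ∀ f → f 0ℤ ≡ 0ℤ → ∀ ts A → Unique (map termVar ts) →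
           sumCf f (mk ts A) ≡ sumTerms (f ∘ signed) ts
sumCf-mk f f0 ts A distinct = begin
  sumTo M (λ v → f (cf (mk ts A) v))                ≡⟨ sumTo-cong M (cong f ∘ cf-mk ts A) ⟩
  sumTo M (λ v → f (sumTerms (onVar v signed) ts))  ≡⟨ sumTo-cong M (onVar-commute f f0 signed distinct) ⟩
  sumTo M (λ v → sumTerms (onVar v (f ∘ signed)) ts) ≡⟨ sumTo-onVar (f ∘ signed) ts ℕₚ.≤-refl ⟩
  sumTerms (f ∘ signed) ts                          ∎
  where
  open ≡-Reasoning
  M : ℕ
  M = suc (maxVar ts)

ldeg-cong : ∀ {C D} → C ≅ D → ldeg C ≡ ldeg D
ldeg-cong eq = cong₂ ℤ._+_ (_≅_.deg≡ eq) (sumCf-cong (λ z → + negPart z) refl eq)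

ldeg-mk : ∀ ts A → Unique (map termVar ts) → ldeg (mk ts A) ≡ + A
ldeg-mk ts A distinct = begin
  deg (mk ts A) ℤ.+ sumCf (λ z → + negPart z) (mk ts A)
    ≡⟨ cong₂ ℤ._+_ (deg-mk ts A) (sumCf-mk (λ z → + negPart z) refl ts A distinct) ⟩
  (+ A ℤ.- sumTerms negConst ts) ℤ.+ sumTerms (λ t → + negPart (signed t)) ts
    ≡⟨ cong (λ z → (+ A ℤ.- sumTerms negConst ts) ℤ.+ z) (sumTerms-cong ts negPart-signed) ⟩
  (+ A ℤ.- sumTerms negConst ts) ℤ.+ sumTerms negConst ts
    ≡⟨ subtract-add (+ A) (sumTerms negConst ts) ⟩
  + A ∎
  where
  open ≡-Reasoning
  subtract-add : ∀ (a b : ℤ) → (a ℤ.- b) ℤ.+ b ≡ a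
  subtract-add = solve-∀

cf-divide : ∀ c .{{_ : NonZero c}} C v → cf (divide c C) v ≡ ceilCoef c (cf C v)
cf-divide c C v with v <ᵇ bound C
... | true  = refl
... | false = cong +_ (sym (ceilDiv-zero c))

divide-cong : ∀ c .{{_ : NonZero c}} {C D} → C ≅ D → divide c C ≅ divide c D
divide-cong c {C} {D} eq =
  (λ v → trans (cf-divide c C v) (trans (cong (ceilCoef c) (_≅_.cf≗ eq v)) (sym (cf-divide c D v)))) ,
  cong₂ ℤ._-_ (cong (λ z → ceilDivℤ z c) (ldeg-cong eq))
              (sumCf-cong (ceilNeg c) refl eq)

mk-divide : ∀ c .{{_ : NonZero c}} ts A → Unique (map termVar ts) →
            mk (map (ceilTerm c) ts) (ceilDiv A c) ≅ divide c (mk ts A)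
mk-divide c ts A distinct = mk-≅ (map (ceilTerm c) ts) (ceilDiv A c) (divide c (mk ts A))
  (λ v → begin
    sumTerms (onVar v signed) (map (ceilTerm c) ts)  ≡⟨ sumTerms-map (onVar v signed) (ceilTerm c) ts ⟩
    sumTerms (onVar v signed ∘ ceilTerm c) ts        ≡⟨ sumTerms-cong ts (onVar-ceil v) ⟩
    sumTerms (onVar v (ceilCoef c ∘ signed)) ts
      ≡⟨ onVar-commute (ceilCoef c) (cong +_ (ceilDiv-zero c)) signed distinct v ⟨
    ceilCoef c (sumTerms (onVar v signed) ts)        ≡⟨ cong (ceilCoef c) (cf-mk ts A v) ⟨
    ceilCoef c (cf (mk ts A) v)                      ≡⟨ cf-divide c (mk ts A) v ⟨
    cf (divide c (mk ts A)) v                        ∎)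
  (cong₂ ℤ._-_ (cong (λ z → ceilDivℤ z c) (sym (ldeg-mk ts A distinct)))
     (begin
       sumTerms negConst (map (ceilTerm c) ts) ≡⟨ sumTerms-map negConst (ceilTerm c) ts ⟩
       sumTerms (negConst ∘ ceilTerm c) ts     ≡⟨ sumTerms-cong ts (ceilNeg-signed c) ⟨
       sumTerms (ceilNeg c ∘ signed) ts        ≡⟨ sumCf-mk (ceilNeg c) refl ts A distinct ⟨
       sumCf (ceilNeg c) (mk ts A)             ∎))
  where
  open ≡-Reasoning
  onVar-ceil : ∀ v t → onVar v signed (ceilTerm c t) ≡ onVar v (ceilCoef c ∘ signed) t
  onVar-ceil v (a , l) with var l ≡ᵇ v
  ... | true  = sym (ceilCoef-signed c (a , l))
  ... | false = refl

-- Counted derivations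

variable
  Γ : List Con
  ts us : List Term
  A B : ℕ

infix 4 _∋_≥_
data _∋_≥_ (Γ : List Con) (ts : List Term) (A : ℕ) : Set where
  holds : ∀ {C} → C ∈ Γ → mk ts A ≅ C → Γ ∋ ts ≥ A

∋-mono : ∀ {Δ} → Γ ⊆ Δ → Γ ∋ ts ≥ A → Δ ∋ ts ≥ A
∋-mono Γ⊆Δ (holds C∈Γ eq) = holds (Γ⊆Δ C∈Γ) eq

∋-resp : mk ts A ≅ mk us B → Γ ∋ ts ≥ A → Γ ∋ us ≥ B
∋-resp eq (holds C∈Γ eq′) = holds C∈Γ (≅-trans (≅-sym eq) eq′)

∋-↭ : ts ↭ us → Γ ∋ ts ≥ A → Γ ∋ us ≥ A
∋-↭ {A = A} p = ∋-resp (mk-↭ A p)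

pair-mono : ∀ {Δ} → Γ ⊆ Δ → Γ ∋ ts ≥ A × Γ ∋ us ≥ B → Δ ∋ ts ≥ A × Δ ∋ us ≥ B
pair-mono Γ⊆Δ (h , h′) = ∋-mono Γ⊆Δ h , ∋-mono Γ⊆Δ h′

∋⇒Any : Γ ∋ ts ≥ A → Any (mk ts A ≈ᶜ_) Γ
∋⇒Any (holds C∈Γ eq) = lose C∈Γ (≅⇒≈ᶜ eq)

infix 2 _⊢[_]_
record _⊢[_]_ (Γ : List Con) (n : ℕ) (P : List Con → Set) : Set where
  constructor derivation
  field
    {Δ}    : List Con
    steps  : Deriv Γ n Δ
    result : P Δ

Deriv-++ : ∀ {Δ E m n} → Deriv Γ m Δ → Deriv Δ n E → Deriv Γ (m ℕ.+ n) E
Deriv-++ done        d′ = d′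
Deriv-++ (step s d) d′ = step s (Deriv-++ d d′)

Deriv-⊆ : ∀ {Δ n} → Deriv Γ n Δ → Γ ⊆ Δ
Deriv-⊆ done       = ⊆-refl
Deriv-⊆ (step s d) = ⊆-trans there (Deriv-⊆ d)

variable
  P Q : List Con → Set

return : P Γ → Γ ⊢[ 0 ] P
return p = derivation done p

infixl 1 _>>=_ _<&>_

_>>=_ : ∀ {m n} → Γ ⊢[ m ] P → (∀ {Δ} → Γ ⊆ Δ → P Δ → Δ ⊢[ n ] Q) → Γ ⊢[ m ℕ.+ n ] Q
derivation d p >>= k =
  let r = k (Deriv-⊆ d) p in derivation (Deriv-++ d (_⊢[_]_.steps r)) (_⊢[_]_.result r)

_<&>_ : ∀ {n} → Γ ⊢[ n ] P → (∀ {Δ} → Γ ⊆ Δ → P Δ → Q Δ) → Γ ⊢[ n ] Q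
derivation d p <&> f = derivation d (f (Deriv-⊆ d) p)

single-step : ∀ {C} → Step Γ C → mk ts A ≅ C → Γ ⊢[ 1 ] (λ Δ → Δ ∋ ts ≥ A)
single-step s eq = derivation (step s done) (holds (here refl) eq)

add-step : Γ ∋ ts ≥ A → Γ ∋ us ≥ B → Γ ⊢[ 1 ] (λ Δ → Δ ∋ ts ++ us ≥ A ℕ.+ B)
add-step {ts = ts} {A = A} {us = us} {B = B} (holds C∈Γ eq) (holds D∈Γ eq′) =
  single-step (add C∈Γ D∈Γ) (≅-trans (mk-++ ts us A B) (⊕-cong eq eq′))

mul-step : ∀ c .{{_ : NonZero c}} → Γ ∋ ts ≥ A → Γ ⊢[ 1 ] (λ Δ → Δ ∋ map (map₁ (c *_)) ts ≥ c * A)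
mul-step {ts = ts} {A = A} c (holds C∈Γ eq) =
  single-step (mul c C∈Γ) (≅-trans (mk-scale c ts A) (scale-cong c eq))

div-step : ∀ c .{{_ : NonZero c}} → Unique (map termVar ts) → Γ ∋ ts ≥ A →
           Γ ⊢[ 1 ] (λ Δ → Δ ∋ map (ceilTerm c) ts ≥ ceilDiv A c)
div-step {ts = ts} {A = A} c distinct (holds C∈Γ eq) =
  single-step (div c C∈Γ) (≅-trans (mk-divide c ts A distinct) (divide-cong c eq))

axiom-step : ∀ l → Γ ⊢[ 1 ] (λ Δ → Δ ∋ (1 , l) ∷ [] ≥ 0)
axiom-step l = single-step (axiom l) ≅-refl

forEach : ∀ {I : Set} {n} {P : I → List Con → Set} →
          (∀ {i Δ E} → Δ ⊆ E → P i Δ → P i E) → (is : List I) →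
          (∀ {Δ} → Γ ⊆ Δ → ∀ {i} → i ∈ is → Δ ⊢[ n ] P i) →
          Γ ⊢[ length is * n ] (λ Δ → All (λ i → P i Δ) is)
forEach mono []       derive = return []
forEach mono (i ∷ is) derive =
  derive ⊆-refl (here refl) >>= λ Γ⊆Δ p →
  forEach mono is (λ Δ⊆E i∈is → derive (⊆-trans Γ⊆Δ Δ⊆E) (there i∈is)) <&> λ Δ⊆E ps →
  mono Δ⊆E p ∷ ps

cancel-step : ∀ {a l} → Γ ∋ (a , ~ l) ∷ [] ≥ B → Γ ∋ (a , l) ∷ ts ≥ a ℕ.+ A →
              Γ ⊢[ 1 ] (λ Δ → Δ ∋ ts ≥ B ℕ.+ A)
cancel-step {B = B} {ts = ts} {A = A} {a = a} {l = l} h h′ =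
  add-step h h′ <&> λ {Δ} _ h″ →
    ∋-resp (mk-cancel a l ts (B ℕ.+ A)) (subst (Δ ∋ (a , ~ l) ∷ (a , l) ∷ ts ≥_) (+-swapℕ B a A) h″)

-- Weakening, obtained by adding a·l̄ ≥ 0.
drop-step : ∀ a .{{_ : NonZero a}} l → Γ ∋ (a , l) ∷ ts ≥ a ℕ.+ A → Γ ⊢[ 3 ] (λ Δ → Δ ∋ ts ≥ A)
drop-step a l h =
  axiom-step (~ l) >>= λ Γ⊆Δ h₁ →
  mul-step a h₁ >>= λ {E} Δ⊆E h₂ →
  cancel-step (subst₂ (λ b B → E ∋ (b , ~ l) ∷ [] ≥ B) (ℕₚ.*-identityʳ a) (ℕₚ.*-zeroʳ a) h₂)
              (∋-mono (⊆-trans Γ⊆Δ Δ⊆E) h)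

-- 2·Σ ls + x + y ≥ 2 is weakened to 2·Σ ls + x ≥ 1 and then halved.
halve-one : ∀ ls x y → Unique (map var (x ∷ ls)) → Γ ∋ (1 , y) ∷ (1 , x) ∷ map (2 ,_) ls ≥ 2 →
            Γ ⊢[ 4 ] (λ Δ → Δ ∋ map (1 ,_) ls ++ (1 , x) ∷ [] ≥ 1)
halve-one ls x y distinct h =
  drop-step 1 y h >>= λ _ h₁ →
  div-step 2 (subst (λ vs → Unique (var x ∷ vs)) (map-∘ {g = termVar} {f = (2 ,_)} ls) distinct) h₁
    <&> λ {Δ} _ h₂ →
  ∋-↭ (∷↭∷ʳ (1 , x) (map (1 ,_) ls))
      (subst (λ us → Δ ∋ (1 , x) ∷ us ≥ 1) (sym (map-∘ {g = ceilTerm 2} {f = (2 ,_)} ls)) h₂)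

halve : ∀ ls x y → Unique (map var (x ∷ ls)) → Unique (map var (y ∷ ls)) →
        Γ ∋ map (2 ,_) ls ++ (1 , x) ∷ (1 , y) ∷ [] ≥ 2 →
        Γ ⊢[ 8 ] (λ Δ → Δ ∋ map (1 ,_) ls ++ (1 , x) ∷ [] ≥ 1 × Δ ∋ map (1 ,_) ls ++ (1 , y) ∷ [] ≥ 1)
halve ls x y distinct-x distinct-y h =
  halve-one ls x y distinct-x (∋-↭ (↭-trans to-front (swap _ _ ↭-refl)) h) >>= λ Γ⊆Δ hx →
  halve-one ls y x distinct-y (∋-↭ to-front (∋-mono Γ⊆Δ h)) <&> λ Δ⊆E hy →
  ∋-mono Δ⊆E hx , hy
  where
  to-front : map (2 ,_) ls ++ (1 , x) ∷ (1 , y) ∷ [] ↭ (1 , x) ∷ (1 , y) ∷ map (2 ,_) ls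
  to-front = ++-comm (map (2 ,_) ls) ((1 , x) ∷ (1 , y) ∷ [])

isolate : ∀ l l₁ l₂ l₃ → Γ ∋ (3 , l) ∷ (1 , l₁) ∷ (1 , l₂) ∷ (1 , l₃) ∷ [] ≥ 4 →
          Γ ⊢[ 10 ] (λ Δ → Δ ∋ (1 , l) ∷ [] ≥ 1)
isolate l l₁ l₂ l₃ h =
  drop-step 1 l₁ (∋-↭ (swap _ _ ↭-refl) h)  >>= λ _ h₁ →
  drop-step 1 l₂ (∋-↭ (swap _ _ ↭-refl) h₁) >>= λ _ h₂ →
  drop-step 1 l₃ (∋-↭ (swap _ _ ↭-refl) h₂) >>= λ _ h₃ →
  div-step 3 ([] ∷ []) h₃

descend : ∀ l′ l l₁ l₂ l₃ →
          Γ ∋ (4 , l′) ∷ (3 , l) ∷ (1 , l₁) ∷ (1 , l₂) ∷ (1 , l₃) ∷ [] ≥ 4 → Γ ∋ (1 , ~ l′) ∷ [] ≥ 1 →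
          Γ ⊢[ 15 ] (λ Δ → Δ ∋ (1 , l) ∷ [] ≥ 1 × Δ ∋ (1 , l₁) ∷ (1 , l₂) ∷ (1 , l₃) ∷ [] ≥ 1)
descend l′ l l₁ l₂ l₃ h unit =
  mul-step 4 unit                    >>= λ Γ⊆Δ unit₄ →
  cancel-step unit₄ (∋-mono Γ⊆Δ h)   >>= λ _ h₃ →
  drop-step 3 l h₃                   >>= λ Δ⊆E hR →
  isolate l l₁ l₂ l₃ (∋-mono Δ⊆E h₃) <&> λ E⊆F hl →
  hl , ∋-mono E⊆F hR

-- Symmetries and the circuit

σ-injective : ∀ {F σ} → IsSymmetry F σ → ∀ {l m} → σ l ≡ σ m → l ≡ m
σ-injective symmetry {l} {m} σl≡σm with IsSymmetry.σ-perm symmetry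
... | τ , τ∘σ , _ = trans (sym (τ∘σ l)) (trans (cong τ σl≡σm) (τ∘σ m))

var≡-cases : ∀ {l y} → var l ≡ y → l ≡ pos y ⊎ l ≡ neg y
var≡-cases {pos _} refl = inj₁ refl
var≡-cases {neg _} refl = inj₂ refl

var-σ-fixed : ∀ {F σ y l} → IsSymmetry F σ → σ (pos y) ≡ pos y → var (σ l) ≡ y → var l ≡ y
var-σ-fixed {σ = σ} {y} symmetry fixed σl-over-y with var≡-cases σl-over-y
... | inj₁ σl≡y = cong var (σ-injective symmetry (trans σl≡y (sym fixed)))
... | inj₂ σl≡ȳ =
  cong var (σ-injective symmetry
    (trans σl≡ȳ (sym (trans (IsSymmetry.σ-neg symmetry (pos y)) (cong ~_ fixed)))))

nth-∈ : ∀ {xs i} → i < length xs → nth xs i ∈ xs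
nth-∈ {_ ∷ _} {zero}  _         = here refl
nth-∈ {_ ∷ _} {suc i} (s≤s i<n) = there (nth-∈ i<n)

<∸2⇒2+< : ∀ {n j} → j < n ∸ 2 → 2 ℕ.+ j < n
<∸2⇒2+< {suc (suc n)} j<n = s≤s (s≤s j<n)

steps-bound : ∀ k → 1 ≤ k → 8 ℕ.+ ((k ∸ 2) * 8 ℕ.+ ((k ∸ 1) * 15 ℕ.+ 1)) ≤ 24 * k
steps-bound (suc k) _ = begin
  8 ℕ.+ ((k ∸ 1) * 8 ℕ.+ (k * 15 ℕ.+ 1))
    ≤⟨ ℕₚ.+-monoʳ-≤ 8 (ℕₚ.+-monoˡ-≤ _ (ℕₚ.*-monoˡ-≤ 8 (ℕₚ.m∸n≤m k 1))) ⟩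
  8 ℕ.+ (k * 8 ℕ.+ (k * 15 ℕ.+ 1))
    ≤⟨ ℕₚ.m≤m+n _ (15 ℕ.+ k) ⟩
  8 ℕ.+ (k * 8 ℕ.+ (k * 15 ℕ.+ 1)) ℕ.+ (15 ℕ.+ k)
    ≡⟨ regroup k ⟩
  24 * suc k ∎
  where
  open ℕₚ.≤-Reasoning
  regroup : ∀ k → 8 ℕ.+ (k * 8 ℕ.+ (k * 15 ℕ.+ 1)) ℕ.+ (15 ℕ.+ k) ≡ 24 * suc k
  regroup = ℕ-solve-∀

module CircuitDerivation (F : CNF) (σ : Lit → Lit) (xs : List ℕ) (s t : ℕ → ℕ)
  (symmetry : IsSymmetry F σ) (support : IsSupport σ xs) (nonempty : 1 ≤ length xs)
  (fresh : Fresh F xs s t) where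

  open Circuit σ xs s t
  open Fresh fresh using (s-inj; s∉supp)

  x≢s : ∀ {i j} → j < k → SIdx k i → nth xs j ≢ s i
  x≢s {i} j<k si x≡s = s∉supp i si (subst (_∈ xs) x≡s (nth-∈ j<k))

  σx≢s : ∀ {i j} → j < k → SIdx k i → var (σ (pos (nth xs j))) ≢ s i
  σx≢s {i} j<k si σx-over-s = s∉xs (proj₂ (support (s i)) moved)
    where
    s∉xs : s i ∉ xs
    s∉xs = s∉supp i si
    moved : σ (pos (s i)) ≢ pos (s i)
    moved fixed = s∉xs (subst (_∈ xs) (var-σ-fixed symmetry fixed σx-over-s) (nth-∈ j<k))

  premise : ∀ {ts A} → premises ⊆ Γ → mk ts A ∈ premises → Γ ∋ ts ≥ A
  premise sub C∈ = holds (sub C∈) ≅-refl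

  first-pair : premises ⊆ Γ →
               Γ ⊢[ 8 ] (λ Δ → Δ ∋ (1 , S 1) ∷ (1 , ~ x′ 1) ∷ [] ≥ 1 ×
                               Δ ∋ (1 , S 1) ∷ (1 , σ (x′ 1)) ∷ [] ≥ 1)
  first-pair sub =
    halve (S 1 ∷ []) (~ x′ 1) (σ (x′ 1))
          ((x≢s nonempty s₁ ∷ []) ∷ [] ∷ []) ((σx≢s nonempty s₁ ∷ []) ∷ [] ∷ [])
          (premise sub (there (there (here refl))))
    where
    s₁ : SIdx k 1
    s₁ = ℕₚ.≤-refl , ℕₚ.m≤n⊔m (k ∸ 1) 1

  middle-clauses : ℕ → List Con → Set
  middle-clauses j Δ = Δ ∋ (1 , S (suc j)) ∷ (1 , S̄ j) ∷ (1 , ~ x′ (suc j)) ∷ [] ≥ 1 ×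
                       Δ ∋ (1 , S (suc j)) ∷ (1 , S̄ j) ∷ (1 , σ (x′ (suc j))) ∷ [] ≥ 1

  middle-pair : premises ⊆ Γ → ∀ {j} → j ∈ upTo (k ∸ 2) → Γ ⊢[ 8 ] middle-clauses (suc j)
  middle-pair sub {j} j∈ =
    halve (S (2 ℕ.+ j) ∷ S̄ (suc j) ∷ []) (~ x′ (2 ℕ.+ j)) (σ (x′ (2 ℕ.+ j)))
          ((x≢s 1+j<k sₙ ∷ x≢s 1+j<k sₚ ∷ []) ∷ (sₙ≢sₚ ∷ []) ∷ [] ∷ [])
          ((σx≢s 1+j<k sₙ ∷ σx≢s 1+j<k sₚ ∷ []) ∷ (sₙ≢sₚ ∷ []) ∷ [] ∷ [])
          (premise sub (there (there (there (∈-++⁺ˡ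
            (∈-concatMap⁺ _ (lose (∈-map⁺ suc j∈) (there (here refl)))))))))
    where
    2+j<k : 2 ℕ.+ j < k
    2+j<k = <∸2⇒2+< (∈-upTo⁻ j∈)
    1+j<k : suc j < k
    1+j<k = ℕₚ.<⇒≤ 2+j<k
    sₙ : SIdx k (2 ℕ.+ j)
    sₙ = s≤s z≤n , ℕₚ.m≤n⇒m≤n⊔o 1 (ℕₚ.<⇒≤pred 2+j<k)
    sₚ : SIdx k (suc j)
    sₚ = s≤s z≤n , ℕₚ.m≤n⇒m≤n⊔o 1 (ℕₚ.<⇒≤ (ℕₚ.<⇒≤pred 2+j<k))
    sₙ≢sₚ : s (2 ℕ.+ j) ≢ s (suc j)
    sₙ≢sₚ e = ℕₚ.1+n≢n (s-inj _ _ sₙ sₚ e)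

  last-clause : ℕ → List Term
  last-clause j = (1 , S̄ j) ∷ (1 , σ (x′ (suc j))) ∷ (1 , ~ x′ (suc j)) ∷ []

  t-chain : premises ⊆ Γ → ∀ j → j ≤ k ∸ 1 → Γ ∋ (1 , T (suc j)) ∷ [] ≥ 1 →
          Γ ⊢[ j * 15 ] (λ Δ → Δ ∋ (1 , T 1) ∷ [] ≥ 1 × (∀ i → i < j → Δ ∋ last-clause (suc i) ≥ 1))
  t-chain sub zero    _   unit = return (unit , λ _ ())
  t-chain sub (suc j) j<k unit =
    descend (T̄ (2 ℕ.+ j)) (T (suc j)) (S̄ (suc j)) (σ (x′ (2 ℕ.+ j))) (~ x′ (2 ℕ.+ j))
            (premise sub mem) unit >>= λ Γ⊆Δ (unit′ , clause) →
    t-chain (⊆-trans sub Γ⊆Δ) j (ℕₚ.<⇒≤ j<k) unit′ <&> λ Δ⊆E (unit₁ , clauses) →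
    unit₁ , λ i i<1+j → [ clauses i , (λ { refl → ∋-mono Δ⊆E clause }) ]′ (ℕₚ.m<1+n⇒m<n∨m≡n i<1+j)
    where
    mem : mk ((4 , T̄ (2 ℕ.+ j)) ∷ (3 , T (suc j)) ∷ last-clause (suc j)) 4 ∈ premises
    mem = there (there (there (∈-++⁺ʳ _ (there (there
            (∈-concatMap⁺ _ (lose (∈-map⁺ suc (∈-upTo⁺ j<k)) (here refl))))))))

  top-unit : premises ⊆ Γ → Γ ∋ (1 , T (suc (k ∸ 1))) ∷ [] ≥ 1
  top-unit sub = premise sub (subst (λ n → mk ((1 , T n) ∷ []) 1 ∈ premises)
                                    (sym (ℕₚ.suc-pred k ⦃ ℕ.>-nonZero nonempty ⦄)) (here refl))

  bottom : premises ⊆ Γ → Γ ∋ (1 , T̄ 1) ∷ (1 , σ (x′ 1)) ∷ (1 , ~ x′ 1) ∷ [] ≥ 1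
  bottom sub = premise sub (there (there (there (∈-++⁺ʳ _ (here refl)))))

  targets-hold : ∀ {Δ} →
    Δ ∋ (1 , S 1) ∷ (1 , ~ x′ 1) ∷ [] ≥ 1 × Δ ∋ (1 , S 1) ∷ (1 , σ (x′ 1)) ∷ [] ≥ 1 →
    All (λ j → middle-clauses (suc j) Δ) (upTo (k ∸ 2)) →
    Δ ∋ (1 , σ (x′ 1)) ∷ (1 , ~ x′ 1) ∷ [] ≥ 1 →
    (∀ i → i < k ∸ 1 → Δ ∋ last-clause (suc i) ≥ 1) →
    All (λ G → Any (G ≈ᶜ_) Δ) targets
  targets-hold (first₁ , first₂) middles first-last lasts =
    ∋⇒Any first₁ ∷ All.++⁺ (All.map⁺ (All.map⁺ (All.map (∋⇒Any ∘ proj₁) middles)))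
    (∋⇒Any first₂ ∷ All.++⁺ (All.map⁺ (All.map⁺ (All.map (∋⇒Any ∘ proj₂) middles)))
    (∋⇒Any first-last ∷ All.map⁺ (All.map⁺ (All.tabulate (λ i∈ → ∋⇒Any (lasts _ (∈-upTo⁻ i∈)))))))

  step-count : ℕ
  step-count = 8 ℕ.+ (length (upTo (k ∸ 2)) * 8 ℕ.+ ((k ∸ 1) * 15 ℕ.+ 1))

  derivation-of-targets : premises ⊢[ step-count ] (λ Δ → All (λ G → Any (G ≈ᶜ_) Δ) targets)
  derivation-of-targets =
    first-pair ⊆-refl                                                   >>= λ ⊆₁ firsts →
    forEach pair-mono (upTo (k ∸ 2)) (λ ⊆ → middle-pair (⊆-trans ⊆₁ ⊆)) >>= λ ⊆₂ middles →
    t-chain (⊆-trans ⊆₁ ⊆₂) (k ∸ 1) ℕₚ.≤-refl (top-unit (⊆-trans ⊆₁ ⊆₂)) >>= λ ⊆₃ (unit₁ , lasts) →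
    cancel-step unit₁ (bottom (⊆-trans (⊆-trans ⊆₁ ⊆₂) ⊆₃))             <&> λ ⊆₄ first-last →
    targets-hold (pair-mono (⊆-trans (⊆-trans ⊆₂ ⊆₃) ⊆₄) firsts)
                 (All.map (pair-mono (⊆-trans ⊆₃ ⊆₄)) middles)
                 first-last
                 (λ i i<k → ∋-mono ⊆₄ (lasts i i<k))

  step-count≤ : step-count ≤ 24 * k
  step-count≤ = subst (λ n → 8 ℕ.+ (n * 8 ℕ.+ ((k ∸ 1) * 15 ℕ.+ 1)) ≤ 24 * k)
                      (sym (length-upTo (k ∸ 2))) (steps-bound k nonempty)

within : ∀ {n N T} → n ≤ N → Γ ⊢[ n ] (λ Δ → All (λ G → Any (G ≈ᶜ_) Δ) T) → DerivableWithin N Γ T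
within n≤N (derivation steps result) = _ , _ , n≤N , steps , result

lemma17 : ∃[ c ] ∀ (F : CNF) (σ : Lit → Lit) (xs : List ℕ) (s t : ℕ → ℕ) →
    IsSymmetry F σ → IsSupport σ xs → Linked _<_ xs → 1 ≤ length xs →
    Fresh F xs s t →
    DerivableWithin (c * length xs) (Circuit.premises σ xs s t) (Circuit.targets σ xs s t)
lemma17 = 24 , λ F σ xs s t symmetry support _ nonempty fresh →
  let open CircuitDerivation F σ xs s t symmetry support nonempty fresh
  in within step-count≤ derivation-of-targets
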